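{- Let $\Sigma$ be a totally ordered alphabet with at least two letters, let $\mathcal{L}$ be the set of Lyndon words over $\Sigma$ and $\mathrm{co}\text{ - }\mathcal{L}$ the set of co-Lyndon words over $\Sigma$. Then $\mathcal{L} \neq \mathrm{co}\text{ - }\mathcal{L}$ and $\mathcal{L} \cap \mathrm{co}\text{ - }\mathcal{L} = \Sigma$ (the set of one-letter words).
   Context: Strings are finite nonempty words over $\Sigma$. Lexicographic order: $\boldsymbol{u} < \boldsymbol{v}$ iff either $\boldsymbol{u}$ is a proper prefix of $\boldsymbol{v}$, or $\boldsymbol{u} = \boldsymbol{r}a\boldsymbol{s}$, $\boldsymbol{v} = \boldsymbol{r}b\boldsymbol{t}$ with letters $a<b$ and strings $\boldsymbol{r},\boldsymbol{s},\boldsymbol{t}$ (possibly empty). For $\boldsymbol{x} = x_1\cdots x_n$, its reversal is $\overline{\boldsymbol{x}} = x_n \cdots x_1$. Co-lexicographic order $\prec$: $\boldsymbol{u} \prec \boldsymbol{v}$ iff $\overline{\boldsymbol{u}} < \overline{\boldsymbol{v}}$ lexicographically. A rotation of $\boldsymbol{x}=\boldsymbol{u}\boldsymbol{v}$ is $\boldsymbol{v}\boldsymbol{u}$. A string is primitive if it is not of the form $\boldsymbol{w}^k$ with $k>1$. A Lyndon word is a primitive string strictly least in lexicographic order among all its rotations; a co-Lyndon word is a primitive string strictly least in co-lexicographic order among all its rotations. -}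

module Defs where

open import Level using (Level; _⊔_)
open import Data.List using (List; []; _∷_; _++_; reverse; concat; replicate; [_])
open import Data.Nat using (ℕ; _<_)
open import Data.Product using (Σ; ∃; _×_; _,_)
open import Relation.Binary.Core using (Rel)
open import Relation.Binary.PropositionalEquality using (_≡_; _≢_)
open import Relation.Nullary using (¬_)

module Words {a ℓ : Level} {A : Set a} (_<ₐ_ : Rel A ℓ) where

  data _<ˡ_ : List A → List A → Set (a ⊔ ℓ) where
    prefix : ∀ {b t} → [] <ˡ (b ∷ t)
    here   : ∀ {x y s t} → x <ₐ y → (x ∷ s) <ˡ (y ∷ t)
    there  : ∀ {x s t} → s <ˡ t → (x ∷ s) <ˡ (x ∷ t)

  _≺_ : List A → List A → Set (a ⊔ ℓ)
  u ≺ v = reverse u <ˡ reverse v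

  IsString : List A → Set a
  IsString x = x ≢ []

  Primitive : List A → Set a
  Primitive x = ¬ (Σ (List A) λ w → Σ ℕ λ k → (w ≢ []) × (1 < k) × (x ≡ concat (replicate k w)))

  IsLyndon : List A → Set (a ⊔ ℓ)
  IsLyndon x = IsString x × Primitive x ×
    (∀ u v → x ≡ u ++ v → v ++ u ≢ x → x <ˡ (v ++ u))

  IsCoLyndon : List A → Set (a ⊔ ℓ)
  IsCoLyndon x = IsString x × Primitive x ×
    (∀ u v → x ≡ u ++ v → v ++ u ≢ x → x ≺ (v ++ u))

module Submission where

-- Let w = b x e be a Lyndon word of length at least two.
--   * Comparing w with the rotation starting at any letter d shows that the
--     first letter b is minimal among the letters of w; in particular ¬ e < b.
--   * If e = b, comparing w = b x b with its rotation b b x shows that every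
--     letter of x equals b, so w = b^(|x|+2) is not primitive.
-- Hence the first letter of a Lyndon word of length ≥ 2 is strictly below its
-- last letter.  Reversal maps co-Lyndon words to Lyndon words (it commutes with
-- rotation and turns the co-lexicographic order into the lexicographic one),
-- so the last letter of a co-Lyndon word of length ≥ 2 is strictly below its
-- first letter.  A word in both classes therefore has length one, and one-letter
-- words trivially belong to both.  Finally, for letters c < d the word cd is
-- Lyndon but not a single letter, so it is not co-Lyndon: the classes differ.

open import Defs
open import Level using (Level)
open import Data.List using (List; []; _∷_; _++_; [_]; reverse; concat; replicate; length)
open import Data.List.Properties
  using (∷-injectiveˡ; ∷-injectiveʳ; ++-assoc; ++-identityʳ; ≡-dec;
         reverse-++; reverse-selfInverse; unfold-reverse)
open import Data.List.Reverse using (reverseView; []; _∶_∶ʳ_)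
open import Data.Nat using (zero; suc; s≤s; z≤n) renaming (_<_ to _<ℕ_)
open import Data.Product using (∃; ∃₂; _×_; _,_; uncurry)
open import Data.Sum using (_⊎_; inj₁; inj₂)
open import Data.Empty using (⊥-elim)
open import Relation.Binary.Core using (Rel)
open import Relation.Binary.Structures using (IsStrictTotalOrder)
open import Relation.Binary.Definitions using (tri<; tri≈; tri>)
open import Relation.Binary.PropositionalEquality
  using (_≡_; _≢_; refl; sym; trans; cong; subst; module ≡-Reasoning)
open import Relation.Nullary using (¬_; yes; no)
open import Function.Bundles using (_⇔_; mk⇔; Equivalence)

module Powers {a : Level} {A : Set a} where

  power-square : ∀ k (u : List A) → 1 <ℕ k → ∃ λ r → concat (replicate k u) ≡ u ++ u ++ r
  power-square (suc (suc k)) u _ = concat (replicate k u) , refl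
  power-square (suc zero) u (s≤s ())

  power-commutes : ∀ k (u : List A) → concat (replicate k u) ++ u ≡ u ++ concat (replicate k u)
  power-commutes zero    u = sym (++-identityʳ u)
  power-commutes (suc k) u = begin
    (u ++ concat (replicate k u)) ++ u  ≡⟨ ++-assoc u _ u ⟩
    u ++ (concat (replicate k u) ++ u)  ≡⟨ cong (u ++_) (power-commutes k u) ⟩
    u ++ (u ++ concat (replicate k u))  ∎
    where open ≡-Reasoning

  reverse-power : ∀ k (u : List A) → reverse (concat (replicate k u)) ≡ concat (replicate k (reverse u))
  reverse-power zero    u = refl
  reverse-power (suc k) u = begin
    reverse (u ++ concat (replicate k u))            ≡⟨ reverse-++ u _ ⟩
    reverse (concat (replicate k u)) ++ reverse u    ≡⟨ cong (_++ reverse u) (reverse-power k u) ⟩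
    concat (replicate k (reverse u)) ++ reverse u    ≡⟨ power-commutes k (reverse u) ⟩
    reverse u ++ concat (replicate k (reverse u))    ∎
    where open ≡-Reasoning

module LyndonWords {a ℓ : Level} {A : Set a} (_<_ : Rel A ℓ) (sto : IsStrictTotalOrder _≡_ _<_) where
  open Words _<_
  open Powers {A = A}
  open IsStrictTotalOrder sto using (irrefl; asym; compare; _≟_)

  incomparable⇒≡ : ∀ {c d} → ¬ c < d → ¬ d < c → c ≡ d
  incomparable⇒≡ {c} {d} c≮d d≮c with compare c d
  ... | tri< c<d _ _ = ⊥-elim (c≮d c<d)
  ... | tri≈ _ c≡d _ = c≡d
  ... | tri> _ _ d<c = ⊥-elim (d≮c d<c)

  _≤ˡ_ : List A → List A → Set _
  u ≤ˡ v = u ≡ v ⊎ u <ˡ v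

  ≤ˡ-head : ∀ {b d s t} → (b ∷ s) ≤ˡ (d ∷ t) → ¬ d < b
  ≤ˡ-head (inj₁ eq)       d<b = irrefl (sym (∷-injectiveˡ eq)) d<b
  ≤ˡ-head (inj₂ (here b<d)) d<b = asym b<d d<b
  ≤ˡ-head (inj₂ (there _))  d<b = irrefl refl d<b

  ≤ˡ-tail : ∀ {m s t} → (m ∷ s) ≤ˡ (m ∷ t) → s ≤ˡ t
  ≤ˡ-tail (inj₁ eq)         = inj₁ (∷-injectiveʳ eq)
  ≤ˡ-tail (inj₂ (here m<m)) = ⊥-elim (irrefl refl m<m)
  ≤ˡ-tail (inj₂ (there s<t)) = inj₂ s<t

  NoLetterBelow : A → List A → Set _
  NoLetterBelow b x = ∀ u d v → x ≡ u ++ d ∷ v → ¬ d < b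

  lyndon-≤ˡ-rotation : ∀ {w} → IsLyndon w → ∀ u v → w ≡ u ++ v → w ≤ˡ (v ++ u)
  lyndon-≤ˡ-rotation {w} (_ , _ , least) u v w≡uv with ≡-dec _≟_ (v ++ u) w
  ... | yes rot≡w = inj₁ (sym rot≡w)
  ... | no  rot≢w = inj₂ (least u v w≡uv rot≢w)

  lyndon-head-minimal : ∀ {b s} → IsLyndon (b ∷ s) → NoLetterBelow b (b ∷ s)
  lyndon-head-minimal L u d v w≡udv = ≤ˡ-head (lyndon-≤ˡ-rotation L u (d ∷ v) w≡udv)

  constant-power : ∀ b x → NoLetterBelow b x → (x ++ [ b ]) ≤ˡ (b ∷ x)
    → b ∷ x ++ [ b ] ≡ concat (replicate (suc (suc (length x))) [ b ])
  constant-power b []      _       _  = refl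
  constant-power b (c ∷ x) noBelow xb≤bx
    with incomparable⇒≡ (noBelow [] c x refl) (≤ˡ-head xb≤bx)
  ... | refl = cong (b ∷_) (constant-power b x noBelow-x (≤ˡ-tail xb≤bx))
    where
    noBelow-x : NoLetterBelow b x
    noBelow-x u d v x≡udv = noBelow (b ∷ u) d v (cong (b ∷_) x≡udv)

  lyndon-ends-differ : ∀ b x → ¬ IsLyndon (b ∷ x ++ [ b ])
  lyndon-ends-differ b x L@(_ , w-primitive , _) =
    w-primitive ([ b ] , suc (suc (length x)) , (λ ()) , s≤s (s≤s z≤n) ,
               constant-power b x noBelow-x (≤ˡ-tail (lyndon-≤ˡ-rotation L (b ∷ x) [ b ] refl)))
    where
    noBelow-x : NoLetterBelow b x
    noBelow-x u d v x≡udv = lyndon-head-minimal L (b ∷ u) d (v ++ [ b ])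
      (cong (b ∷_) (trans (cong (_++ [ b ]) x≡udv) (++-assoc u (d ∷ v) [ b ])))

  lyndon-first<last : ∀ b x e → IsLyndon (b ∷ x ++ [ e ]) → b < e
  lyndon-first<last b x e L with compare b e
  ... | tri< b<e _ _ = b<e
  ... | tri≈ _ refl _ = ⊥-elim (lyndon-ends-differ b x L)
  ... | tri> _ _ e<b = ⊥-elim (lyndon-head-minimal L (b ∷ x) e [] refl e<b)

  colyndon-reverse : ∀ {w} → IsCoLyndon w → IsLyndon (reverse w)
  colyndon-reverse {w} (nonempty , w-primitive , least) = nonempty′ , rw-primitive , least′
    where
    nonempty′ : reverse w ≢ []
    nonempty′ rw≡[] = nonempty (sym (reverse-selfInverse rw≡[]))

    rw-primitive : Primitive (reverse w)
    rw-primitive (u , k , u≢[] , 1<k , rw≡uᵏ) =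
      w-primitive (reverse u , k , (λ ru≡[] → u≢[] (sym (reverse-selfInverse ru≡[]))) , 1<k ,
                 trans (sym (reverse-selfInverse rw≡uᵏ)) (reverse-power k u))

    least′ : ∀ u v → reverse w ≡ u ++ v → v ++ u ≢ reverse w → reverse w <ˡ (v ++ u)
    least′ u v rw≡uv vu≢rw =
      subst (reverse w <ˡ_) (reverse-selfInverse (reverse-++ v u))
        (least (reverse v) (reverse u) w≡split rot≢w)
      where
      w≡split : w ≡ reverse v ++ reverse u
      w≡split = trans (sym (reverse-selfInverse rw≡uv)) (reverse-++ u v)

      rot≢w : reverse u ++ reverse v ≢ w
      rot≢w rot≡w = vu≢rw (sym (reverse-selfInverse (trans (reverse-++ v u) rot≡w)))

  colyndon-last<first : ∀ b x e → IsCoLyndon (b ∷ x ++ [ e ]) → e < b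
  colyndon-last<first b x e C =
    lyndon-first<last e (reverse x) b (subst IsLyndon reversed (colyndon-reverse C))
    where
    reversed : reverse (b ∷ x ++ [ e ]) ≡ e ∷ reverse x ++ [ b ]
    reversed = trans (reverse-++ (b ∷ x) [ e ]) (cong (e ∷_) (unfold-reverse b x))

  lyndon∩colyndon⇒letter : ∀ w → IsLyndon w → IsCoLyndon w → ∃ λ c → w ≡ [ c ]
  lyndon∩colyndon⇒letter []      (nonempty , _) _ = ⊥-elim (nonempty refl)
  lyndon∩colyndon⇒letter (b ∷ s) L C with reverseView s
  ... | []          = b , refl
  ... | x ∶ _ ∶ʳ e = ⊥-elim (asym (lyndon-first<last b x e L) (colyndon-last<first b x e C))

  letter-rotation : ∀ (c : A) u v → [ c ] ≡ u ++ v → v ++ u ≡ [ c ]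
  letter-rotation c []      (d ∷ []) refl = refl
  letter-rotation c (d ∷ []) []      refl = refl

  -- A one-letter word is primitive: it is too short to contain a square.
  letter-primitive : ∀ c → Primitive [ c ]
  letter-primitive c (u , k , u≢[] , 1<k , c≡uᵏ) with power-square k u 1<k
  ... | r , uᵏ≡uur = square-free u u≢[] r (trans c≡uᵏ uᵏ≡uur)
    where
    square-free : ∀ u → u ≢ [] → ∀ r → [ c ] ≢ u ++ u ++ r
    square-free []        u≢[] r _ = u≢[] refl
    square-free (f ∷ [])    _  r ()
    square-free (f ∷ g ∷ u) _  r ()

  letter-lyndon : ∀ c → IsLyndon [ c ]
  letter-lyndon c = (λ ()) , letter-primitive c ,
    λ u v c≡uv rot≢c → ⊥-elim (rot≢c (letter-rotation c u v c≡uv))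

  letter-colyndon : ∀ c → IsCoLyndon [ c ]
  letter-colyndon c = (λ ()) , letter-primitive c ,
    λ u v c≡uv rot≢c → ⊥-elim (rot≢c (letter-rotation c u v c≡uv))

  pair-lyndon : ∀ {c d} → c < d → IsLyndon (c ∷ d ∷ [])
  pair-lyndon {c} {d} c<d = (λ ()) , cd-primitive , least
    where
    cd-primitive : Primitive (c ∷ d ∷ [])
    cd-primitive (u , k , u≢[] , 1<k , cd≡uᵏ) with power-square k u 1<k
    ... | r , uᵏ≡uur = square-free u u≢[] r (trans cd≡uᵏ uᵏ≡uur)
      where
      square-free : ∀ u → u ≢ [] → ∀ r → c ∷ d ∷ [] ≢ u ++ u ++ r
      square-free []            u≢[] r _ = u≢[] refl
      square-free (f ∷ [])      _    r eq = irrefl (trans (∷-injectiveˡ eq)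
                                              (sym (∷-injectiveˡ (∷-injectiveʳ eq)))) c<d
      square-free (f ∷ g ∷ [])  _    r ()
      square-free (f ∷ g ∷ h ∷ u) _  r ()

    least : ∀ u v → c ∷ d ∷ [] ≡ u ++ v → v ++ u ≢ c ∷ d ∷ [] → (c ∷ d ∷ []) <ˡ (v ++ u)
    least []          _ refl rot≢w = ⊥-elim (rot≢w refl)
    least (_ ∷ [])    _ refl _     = here c<d
    least (_ ∷ _ ∷ []) [] refl rot≢w = ⊥-elim (rot≢w refl)

  lyndon≢colyndon : ∀ {c d} → c < d → ¬ (∀ w → IsLyndon w ⇔ IsCoLyndon w)
  lyndon≢colyndon {c} {d} c<d same =
    cd-not-letter (lyndon∩colyndon⇒letter _ cd-lyndon (Equivalence.to (same _) cd-lyndon))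
    where
    cd-lyndon : IsLyndon (c ∷ d ∷ [])
    cd-lyndon = pair-lyndon c<d

    cd-not-letter : ¬ ∃ λ e → c ∷ d ∷ [] ≡ [ e ]
    cd-not-letter (_ , ())

lemma2 : {a ℓ : Level} (A : Set a) (_<ₐ_ : Rel A ℓ)
    → IsStrictTotalOrder _≡_ _<ₐ_
    → (∃₂ λ (x y : A) → x ≢ y)
    → (¬ (∀ (w : List A) → Words.IsLyndon _<ₐ_ w ⇔ Words.IsCoLyndon _<ₐ_ w))
    × (∀ (w : List A) → (Words.IsLyndon _<ₐ_ w × Words.IsCoLyndon _<ₐ_ w) ⇔ (∃ λ (c : A) → w ≡ [ c ]))
lemma2 A _<ₐ_ sto (x , y , x≢y) = classes-differ , intersection
  where
  open LyndonWords _<ₐ_ sto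
  open IsStrictTotalOrder sto using (compare)

  classes-differ : ¬ (∀ w → Words.IsLyndon _<ₐ_ w ⇔ Words.IsCoLyndon _<ₐ_ w)
  classes-differ with compare x y
  ... | tri< x<y _ _ = lyndon≢colyndon x<y
  ... | tri≈ _ x≡y _ = ⊥-elim (x≢y x≡y)
  ... | tri> _ _ y<x = lyndon≢colyndon y<x

  intersection : ∀ w → (Words.IsLyndon _<ₐ_ w × Words.IsCoLyndon _<ₐ_ w) ⇔ (∃ λ c → w ≡ [ c ])
  intersection w = mk⇔ (uncurry (lyndon∩colyndon⇒letter w))
                       (λ { (c , refl) → letter-lyndon c , letter-colyndon c })
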